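{- Let $T$ be a semistandard reverse tableau of straight shape $\lambda$ and $i\ge1$ such that $\lambda$ has an addable node in column $i+1$. Let $T_{(r,i)}$ be the entry of column $i$ that moves horizontally (into column $i+1$) during the computation of $\mathrm{jdt}_{i+1}(T)$. Define the filling $T'$ by $T'_{(p,q)}=T_{(p,q)}$ for $q\ne i$; $T'_{(p,i)}=T_{(p,i)}$ for $p<r$; and $T'_{(p,i)}=T_{(p+1,i)}$ for $p\ge r$ (so column $i$ loses one box). Then $T'$ is a semistandard reverse tableau (of straight partition shape).
   Context: Partitions are drawn in French convention (rows numbered bottom to top, columns left to right; $(r,c)$ is row $r$, column $c$; $T_{(r,c)}$ is the entry there). A semistandard reverse tableau (SSRT) of shape $\lambda$ is a filling of $\lambda$ by positive integers, weakly decreasing along rows from left to right and strictly decreasing along columns from bottom to top. An addable node of $\lambda$ is a box outside $\lambda$ whose addition gives a partition. Backward slide $\mathrm{jdt}_{c_0}(T)$ from the addable node $(r_0,c_0)$: put a hole at $c=(r_0,c_0)$; while $c=(r,s)\ne(1,1)$, let $c'$ be the box among $(r-1,s)$, $(r,s-1)$ (those in $\lambda$) holding the smaller entry (if equal take $(r-1,s)$; if only one exists take it), move its entry into $c$ and set $c:=c'$. During $\mathrm{jdt}_{i+1}(T)$ exactly one entry moves from column $i$ to column $i+1$. -}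

module Defs where

open import Data.Nat using (ℕ; zero; suc; _+_; _∸_; _≤_; _<_; _≤ᵇ_; _<ᵇ_; _≡ᵇ_)
open import Data.Bool using (Bool; true; false; _∧_; if_then_else_)
open import Data.List using (List; []; _∷_)
open import Data.List.Relation.Unary.All using (All)
open import Data.List.Relation.Unary.Linked using (Linked)
open import Data.Product using (_×_; _,_)
open import Data.Sum using (_⊎_)
open import Relation.Binary.PropositionalEquality using (_≡_; _≢_)
open import Relation.Nullary using (¬_)

-- Positions are (row, column), both 1-indexed, French convention
-- (row 1 is the bottom row).

IsPartition : List ℕ → Set
IsPartition la = Linked (λ a b → b ≤ a) la × All (λ a → 1 ≤ a) la

rowLen : List ℕ → ℕ → ℕ
rowLen []       _             = 0
rowLen (x ∷ xs) zero          = 0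
rowLen (x ∷ xs) (suc zero)    = x
rowLen (x ∷ xs) (suc (suc r)) = rowLen xs (suc r)

InShape : List ℕ → ℕ → ℕ → Set
InShape la r c = 1 ≤ r × 1 ≤ c × c ≤ rowLen la r

inShapeᵇ : List ℕ → ℕ → ℕ → Bool
inShapeᵇ la r c = (1 ≤ᵇ r) ∧ (1 ≤ᵇ c) ∧ (c ≤ᵇ rowLen la r)

-- A filling is a function (row, column) ↦ entry; only values on boxes matter.
Filling : Set
Filling = ℕ → ℕ → ℕ

SSRT : List ℕ → Filling → Set
SSRT la T =
  (∀ r c → InShape la r c → 1 ≤ T r c) ×
  (∀ r c → InShape la r c → InShape la r (suc c) → T r (suc c) ≤ T r c) ×
  (∀ r c → InShape la r c → InShape la (suc r) c → T (suc r) c < T r c)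

-- (r , c) is an addable node of la: a box outside la whose addition gives
-- a partition (i.e. its left and lower neighbours, when they exist, are in la)
Addable : List ℕ → ℕ → ℕ → Set
Addable la r c =
  1 ≤ r × 1 ≤ c × ¬ InShape la r c ×
  (c ≡ 1 ⊎ InShape la r (c ∸ 1)) ×
  (r ≡ 1 ⊎ InShape la (r ∸ 1) c)

Pos : Set
Pos = ℕ × ℕ

-- A move of an entry: (source box , target box)
Move : Set
Move = Pos × Pos

-- The list of moves performed by the backward slide, with the hole
-- currently at (r , s); fuel bounds the number of steps.
slideMoves : List ℕ → Filling → ℕ → ℕ → ℕ → List Move
slideMoves la T zero    r s = []
slideMoves la T (suc f) r s =
  if (r ≡ᵇ 1) ∧ (s ≡ᵇ 1) then []
  else step (inShapeᵇ la (r ∸ 1) s) (inShapeᵇ la r (s ∸ 1))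
  where
    goDown : List Move
    goDown = ((r ∸ 1 , s) , (r , s)) ∷ slideMoves la T f (r ∸ 1) s
    goLeft : List Move
    goLeft = ((r , s ∸ 1) , (r , s)) ∷ slideMoves la T f r (s ∸ 1)
    step : Bool → Bool → List Move
    step true  true  = if T (r ∸ 1) s ≤ᵇ T r (s ∸ 1) then goDown else goLeft
    step true  false = goDown
    step false true  = goLeft
    step false false = []

-- all moves of jdt_{c0}(T) started at the addable node (r0 , c0);
-- r0 + c0 steps suffice since each step decreases r + s by one
jdtMoves : List ℕ → Filling → ℕ → ℕ → List Move
jdtMoves la T r0 c0 = slideMoves la T (r0 + c0) r0 c0

deleteInColumn : Filling → ℕ → ℕ → Filling
deleteInColumn T i r p q =
  if q ≡ᵇ i then (if p <ᵇ r then T p i else T (suc p) i) else T p q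

InShape' : List ℕ → ℕ → ℕ → ℕ → Set
InShape' la i p q = (q ≢ i × InShape la p q) ⊎ (q ≡ i × 1 ≤ p × InShape la (suc p) i)

-- During the slide the hole goes down column i+1 from the addable node (r0, i+1) to
-- row r and then steps left. Each downward step from row p+1 to row p chose T(p, i+1)
-- over its competitor T(p+1, i), so T(p, i+1) ≤ T(p+1, i) for r ≤ p < r0. Deleting
-- (r, i) shifts the column-i entries from row r on down by one; that inequality is
-- exactly what keeps the rows of T' weakly decreasing across columns i and i+1, and
-- every other condition is inherited from T. Since column i contains row r0 and
-- column i+1 does not, the top box of column i ends a row of length exactly i, so
-- removing it leaves a partition.
module Submission where

open import Defs
open import Data.Nat using (ℕ; zero; suc; _+_; _≤_; _<_; _∸_; _≟_; _≤?_; _<?_; _≤′_; ≤′-refl; ≤′-step; _≡ᵇ_; _<ᵇ_; _≤ᵇ_; z≤n; s≤s)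
open import Data.Nat.Properties
open import Data.Bool using (true; false; _∧_)
open import Data.Bool.Properties using (∧-zeroʳ)
open import Data.List using (List; []; _∷_)
open import Data.List.Relation.Unary.All using ([]; _∷_)
open import Data.List.Relation.Unary.Linked as Linked using (Linked; []; [-]; _∷_)
open import Data.List.Relation.Unary.Any using (here; there)
open import Data.List.Membership.Propositional using (_∈_)
open import Data.Product using (_×_; _,_; ∃-syntax; proj₁; proj₂)
open import Data.Sum using (inj₁; inj₂)
open import Data.Empty using (⊥-elim)
open import Relation.Nullary using (¬_; Dec; yes; no; _×-dec_)
open import Relation.Nullary.Reflects using (Reflects; ofʸ; ofⁿ; fromEquivalence; _×-reflects_)
open import Relation.Binary.PropositionalEquality using (_≡_; _≢_; refl; sym; trans; cong; subst)

Descending : List ℕ → Set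
Descending = Linked (λ a b → b ≤ a)

rowLen-zero : ∀ la → rowLen la 0 ≡ 0
rowLen-zero []      = refl
rowLen-zero (_ ∷ _) = refl

rowLen-tail≤head : ∀ {x xs} → Descending (x ∷ xs) → rowLen xs 1 ≤ x
rowLen-tail≤head [-]       = z≤n
rowLen-tail≤head (y≤x ∷ _) = y≤x

descending-∷ : ∀ {x ys} → rowLen ys 1 ≤ x → Descending ys → Descending (x ∷ ys)
descending-∷ {ys = []}    _   _    = [-]
descending-∷ {ys = _ ∷ _} y≤x desc = y≤x ∷ desc

rowLen-suc-≤ : ∀ {la} → Descending la → ∀ p → rowLen la (suc (suc p)) ≤ rowLen la (suc p)
rowLen-suc-≤ []         _       = z≤n
rowLen-suc-≤ [-]        zero    = z≤n
rowLen-suc-≤ [-]        (suc _) = z≤n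
rowLen-suc-≤ (y≤x ∷ _)  zero    = y≤x
rowLen-suc-≤ (_ ∷ desc) (suc p) = rowLen-suc-≤ desc p

rowLen-antitone : ∀ {la} → Descending la → ∀ {q p} → 1 ≤ q → q ≤ p → rowLen la p ≤ rowLen la q
rowLen-antitone {la} desc {suc q} {suc _} _ (s≤s q≤p) = go (≤⇒≤′ q≤p)
  where
  go : ∀ {p} → q ≤′ p → rowLen la (suc p) ≤ rowLen la (suc q)
  go ≤′-refl          = ≤-refl
  go (≤′-step q≤′p) = ≤-trans (rowLen-suc-≤ desc _) (go q≤′p)

InShape-below : ∀ {la} → Descending la → ∀ {p c} → 1 ≤ p → InShape la (suc p) c → InShape la p c
InShape-below desc 1≤p (_ , 1≤c , c≤) = 1≤p , 1≤c , ≤-trans c≤ (rowLen-antitone desc 1≤p (n≤1+n _))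

InShape-left : ∀ {la p c} → 1 ≤ c → InShape la p (suc c) → InShape la p c
InShape-left 1≤c (1≤p , _ , c<) = 1≤p , 1≤c , ≤-trans (n≤1+n _) c<

inShapeᵇ-reflects : ∀ la r c → Reflects (InShape la r c) (inShapeᵇ la r c)
inShapeᵇ-reflects la r c =
  ≤ᵇ-reflects-≤ 1 r ×-reflects ≤ᵇ-reflects-≤ 1 c ×-reflects ≤ᵇ-reflects-≤ c (rowLen la r)

≡ᵇ-reflects-≡ : ∀ m n → Reflects (m ≡ n) (m ≡ᵇ n)
≡ᵇ-reflects-≡ m n = fromEquivalence (≡ᵇ⇒≡ m n) (≡⇒≡ᵇ m n)

-- (p, i) is a removable corner: the last box of row p and the top box of column i.
IsCorner : List ℕ → ℕ → ℕ → Set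
IsCorner la i p = rowLen la p ≡ i × rowLen la (suc p) < i

IsCorner? : ∀ la i p → Dec (IsCorner la i p)
IsCorner? la i p = rowLen la p ≟ i ×-dec rowLen la (suc p) <? i

-- A row emptied by the decrement is dropped; for a partition this only happens to the last row.
decHead : ℕ → List ℕ → List ℕ
decHead 1 [] = []
decHead x ys = x ∸ 1 ∷ ys

rowLen-decHead : ∀ x ys p → rowLen (decHead x ys) p ≡ rowLen (x ∸ 1 ∷ ys) p
rowLen-decHead zero          ys       p             = refl
rowLen-decHead (suc zero)    []       zero          = refl
rowLen-decHead (suc zero)    []       (suc zero)    = refl
rowLen-decHead (suc zero)    []       (suc (suc p)) = refl
rowLen-decHead (suc zero)    (_ ∷ _)  p             = refl
rowLen-decHead (suc (suc x)) ys       p             = refl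

rowLen-decHead-≤ : ∀ x ys p → rowLen (decHead x ys) p ≤ rowLen (x ∷ ys) p
rowLen-decHead-≤ x ys zero          = ≤-reflexive (rowLen-zero (decHead x ys))
rowLen-decHead-≤ x ys (suc zero)    = subst (_≤ x) (sym (rowLen-decHead x ys 1)) (m∸n≤m x 1)
rowLen-decHead-≤ x ys (suc (suc p)) = ≤-reflexive (rowLen-decHead x ys (suc (suc p)))

decHead-isPartition : ∀ {x ys} → 1 ≤ x → rowLen ys 1 ≤ x ∸ 1 → IsPartition ys → IsPartition (decHead x ys)
decHead-isPartition {suc zero}    {[]}    _ _   _                 = [] , []
decHead-isPartition {suc zero}    {_ ∷ _} _ z≤n (_ , () ∷ _)
decHead-isPartition {suc (suc _)}         _ y≤x (desc , positive) = descending-∷ y≤x desc , s≤s z≤n ∷ positive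

dropColumnTop : ℕ → List ℕ → List ℕ
dropColumnTop i []       = []
dropColumnTop i (x ∷ xs) with IsCorner? (x ∷ xs) i 1
... | yes _ = decHead x xs
... | no _  = x ∷ dropColumnTop i xs

rowLen-dropColumnTop-≤ : ∀ i la p → rowLen (dropColumnTop i la) p ≤ rowLen la p
rowLen-dropColumnTop-≤ i []       p    = ≤-refl
rowLen-dropColumnTop-≤ i (x ∷ xs) zero = ≤-reflexive (rowLen-zero (dropColumnTop i (x ∷ xs)))
rowLen-dropColumnTop-≤ i (x ∷ xs) (suc p) with IsCorner? (x ∷ xs) i 1
... | yes _ = rowLen-decHead-≤ x xs (suc p)
rowLen-dropColumnTop-≤ i (x ∷ xs) (suc zero)    | no _ = ≤-refl
rowLen-dropColumnTop-≤ i (x ∷ xs) (suc (suc p)) | no _ = rowLen-dropColumnTop-≤ i xs (suc p)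

rowLen-dropColumnTop-¬corner : ∀ i la p → ¬ IsCorner la i p → rowLen (dropColumnTop i la) p ≡ rowLen la p
rowLen-dropColumnTop-¬corner i []       p    _ = refl
rowLen-dropColumnTop-¬corner i (x ∷ xs) zero _ = rowLen-zero (dropColumnTop i (x ∷ xs))
rowLen-dropColumnTop-¬corner i (x ∷ xs) (suc zero) ¬corner with IsCorner? (x ∷ xs) i 1
... | yes corner = ⊥-elim (¬corner corner)
... | no _       = refl
rowLen-dropColumnTop-¬corner i (x ∷ xs) (suc (suc p)) ¬corner with IsCorner? (x ∷ xs) i 1
... | yes _ = rowLen-decHead x xs (suc (suc p))
... | no _  = rowLen-dropColumnTop-¬corner i xs (suc p) ¬corner

rowLen-dropColumnTop-corner : ∀ i {la} → Descending la → ∀ p → IsCorner la i p → rowLen (dropColumnTop i la) p ≡ i ∸ 1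
rowLen-dropColumnTop-corner i {[]}     _    p    (refl , ())
rowLen-dropColumnTop-corner i {x ∷ xs} _    zero (refl , ())
rowLen-dropColumnTop-corner i {x ∷ xs} _    (suc zero) corner with IsCorner? (x ∷ xs) i 1
... | yes _       = trans (rowLen-decHead x xs 1) (cong (_∸ 1) (proj₁ corner))
... | no ¬corner  = ⊥-elim (¬corner corner)
rowLen-dropColumnTop-corner i {x ∷ xs} desc (suc (suc p)) corner with IsCorner? (x ∷ xs) i 1
... | yes (_ , xs<i) = ⊥-elim (<⇒≱ xs<i (subst (_≤ rowLen xs 1) (proj₁ corner)
                         (rowLen-antitone (Linked.tail desc) (s≤s z≤n) (s≤s z≤n))))
... | no _           = rowLen-dropColumnTop-corner i (Linked.tail desc) (suc p) corner

dropColumnTop-isPartition : ∀ i {la} → IsPartition la → IsPartition (dropColumnTop i la)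
dropColumnTop-isPartition i {[]}     _                        = [] , []
dropColumnTop-isPartition i {x ∷ xs} (desc , 1≤x ∷ positive) with IsCorner? (x ∷ xs) i 1
... | yes (refl , xs<x) = decHead-isPartition 1≤x (<⇒≤pred xs<x) (Linked.tail desc , positive)
... | no _ =
  let desc′ , positive′ = dropColumnTop-isPartition i (Linked.tail desc , positive)
  in descending-∷ (≤-trans (rowLen-dropColumnTop-≤ i xs 1) (rowLen-tail≤head desc)) desc′ , 1≤x ∷ positive′

addable-rowLen : ∀ {la r0 j} → Addable la r0 (suc (suc j)) → rowLen la r0 ≡ suc j
addable-rowLen (_ ,     _ , _ ,     inj₁ () , _)
addable-rowLen (1≤r0 , _ , notIn , inj₂ (_ , _ , j+1≤) , _) =
  ≤-antisym (≤-pred (≰⇒> λ j+2≤ → notIn (1≤r0 , s≤s z≤n , j+2≤))) j+1≤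

module _ {la : List ℕ} (desc : Descending la) {i r0 : ℕ} (1≤r0 : 1 ≤ r0) (rowLen-r0 : rowLen la r0 ≡ i) where

  below-column-end : ∀ {p} → InShape la p (suc i) → p < r0
  below-column-end {p} (_ , _ , i<) with p <? r0
  ... | yes p<r0 = p<r0
  ... | no p≮r0  = ⊥-elim (<⇒≱ i< (subst (rowLen la p ≤_) rowLen-r0 (rowLen-antitone desc 1≤r0 (≮⇒≥ p≮r0))))

  column-top-isCorner : ∀ {p} → rowLen la (suc p) < i → i ≤ rowLen la p → IsCorner la i p
  column-top-isCorner {p} above< i≤ with suc p ≤? r0
  ... | yes p<r0 = ⊥-elim (<⇒≱ above< (subst (_≤ rowLen la (suc p)) rowLen-r0 (rowLen-antitone desc (s≤s z≤n) p<r0)))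
  ... | no p≮r0  = ≤-antisym (subst (rowLen la p ≤_) rowLen-r0 (rowLen-antitone desc 1≤r0 (≤-pred (≰⇒> p≮r0)))) i≤ , above<

  dropColumnTop-InShape⇒ : ∀ p q → InShape (dropColumnTop i la) p q → InShape' la i p q
  dropColumnTop-InShape⇒ p q (1≤p , 1≤q , q≤) with q ≟ i
  ... | no q≢i = inj₁ (q≢i , 1≤p , 1≤q , ≤-trans q≤ (rowLen-dropColumnTop-≤ i la p))
  ... | yes refl with q ≤? rowLen la (suc p)
  ...   | yes q≤above = inj₂ (refl , 1≤p , s≤s z≤n , 1≤q , q≤above)
  ...   | no q≰above  = ⊥-elim (<⇒≱ (∸-monoʳ-< (s≤s z≤n) 1≤q) (subst (q ≤_) (rowLen-dropColumnTop-corner q desc p corner) q≤))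
    where
    corner : IsCorner la q p
    corner = column-top-isCorner (≰⇒> q≰above) (≤-trans q≤ (rowLen-dropColumnTop-≤ q la p))

dropColumnTop-InShape⇐ : ∀ {la} → Descending la → ∀ {i} → 1 ≤ i → ∀ p q → InShape' la i p q → InShape (dropColumnTop i la) p q
dropColumnTop-InShape⇐ {la} desc {i} _ p q (inj₁ (q≢i , 1≤p , 1≤q , q≤)) = 1≤p , 1≤q , q≤dropped
  where
  q≤dropped : q ≤ rowLen (dropColumnTop i la) p
  q≤dropped with IsCorner? la i p
  ... | yes corner = subst (q ≤_) (sym (rowLen-dropColumnTop-corner i desc p corner))
                       (<⇒≤pred (≤∧≢⇒< (subst (q ≤_) (proj₁ corner) q≤) q≢i))
  ... | no ¬corner = subst (q ≤_) (sym (rowLen-dropColumnTop-¬corner i la p ¬corner)) q≤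
dropColumnTop-InShape⇐ {la} desc 1≤i p _ (inj₂ (refl , 1≤p , _ , _ , i≤above)) =
  1≤p , 1≤i , subst (_ ≤_) (sym (rowLen-dropColumnTop-¬corner _ la p λ (_ , above<) → <⇒≱ above< i≤above))
                (≤-trans i≤above (rowLen-antitone desc 1≤p (n≤1+n p)))

UpperLeftBounded : List ℕ → Filling → ℕ → ℕ → ℕ → Set
UpperLeftBounded la T i lo hi =
  ∀ p → lo ≤ p → p < hi → InShape la p (suc i) → InShape la (suc p) i → T p (suc i) ≤ T (suc p) i

UpperLeftBounded-extend : ∀ {la T i q hi} → UpperLeftBounded la T i q hi →
  (InShape la (q ∸ 1) (suc i) → InShape la q i → T (q ∸ 1) (suc i) ≤ T q i) →
  UpperLeftBounded la T i (q ∸ 1) hi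
UpperLeftBounded-extend {q = zero}  bound _   = bound
UpperLeftBounded-extend {q = suc q} bound new p q≤p with m≤n⇒m<n∨m≡n q≤p
... | inj₁ q<p  = bound p q<p
... | inj₂ refl = λ _ → new

slideMoves-target-column-≤ : ∀ la T f r s {mv : Move} → mv ∈ slideMoves la T f r s → proj₂ (proj₂ mv) ≤ s
slideMoves-target-column-≤ la T zero    r s ()
slideMoves-target-column-≤ la T (suc f) r s = byCases
  where
  viaDown : ∀ {mv : Move} → mv ∈ ((r ∸ 1 , s) , (r , s)) ∷ slideMoves la T f (r ∸ 1) s → proj₂ (proj₂ mv) ≤ s
  viaDown (here refl) = ≤-refl
  viaDown (there m)   = slideMoves-target-column-≤ la T f (r ∸ 1) s m

  viaLeft : ∀ {mv : Move} → mv ∈ ((r , s ∸ 1) , (r , s)) ∷ slideMoves la T f r (s ∸ 1) → proj₂ (proj₂ mv) ≤ s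
  viaLeft (here refl) = ≤-refl
  viaLeft (there m)   = ≤-trans (slideMoves-target-column-≤ la T f r (s ∸ 1) m) (m∸n≤m s 1)

  byCases : ∀ {mv : Move} → mv ∈ slideMoves la T (suc f) r s → proj₂ (proj₂ mv) ≤ s
  byCases m with (r ≡ᵇ 1) ∧ (s ≡ᵇ 1)
  byCases () | true
  ... | false with inShapeᵇ la (r ∸ 1) s | inShapeᵇ la r (s ∸ 1)
  ...   | true  | true with T (r ∸ 1) s ≤ᵇ T r (s ∸ 1)
  ...     | true  = viaDown m
  ...     | false = viaLeft m
  byCases m | false | true  | false = viaDown m
  byCases m | false | false | true  = viaLeft m
  byCases () | false | false | false

-- Only the last step of the slide moves an entry from column i to column i+1; every
-- earlier step went down column i+1 and recorded one more instance of the bound.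
slide-UpperLeftBounded : ∀ la T j hi f q r → UpperLeftBounded la T (suc j) q hi →
  ((r , suc j) , (r , suc (suc j))) ∈ slideMoves la T f q (suc (suc j)) →
  UpperLeftBounded la T (suc j) r hi
slide-UpperLeftBounded la T j hi zero    q r bound ()
slide-UpperLeftBounded la T j hi (suc f) q r bound = byCases
  where
  viaDown : (InShape la (q ∸ 1) (suc (suc j)) → InShape la q (suc j) → T (q ∸ 1) (suc (suc j)) ≤ T q (suc j)) →
    ((r , suc j) , (r , suc (suc j))) ∈ ((q ∸ 1 , suc (suc j)) , (q , suc (suc j))) ∷ slideMoves la T f (q ∸ 1) (suc (suc j)) →
    UpperLeftBounded la T (suc j) r hi
  viaDown _   (here ())
  viaDown new (there m) = slide-UpperLeftBounded la T j hi f (q ∸ 1) r (UpperLeftBounded-extend {la} {T} bound new) m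

  viaLeft : ((r , suc j) , (r , suc (suc j))) ∈ ((q , suc j) , (q , suc (suc j))) ∷ slideMoves la T f q (suc j) →
    UpperLeftBounded la T (suc j) r hi
  viaLeft (here refl) = bound
  viaLeft (there m)   = ⊥-elim (1+n≰n (slideMoves-target-column-≤ la T f q (suc j) m))

  byCases : ((r , suc j) , (r , suc (suc j))) ∈ slideMoves la T (suc f) q (suc (suc j)) → UpperLeftBounded la T (suc j) r hi
  byCases m rewrite ∧-zeroʳ (q ≡ᵇ 1)
    with inShapeᵇ la (q ∸ 1) (suc (suc j)) | inShapeᵇ la q (suc j) | inShapeᵇ-reflects la q (suc j)
  ... | true | true | _
      with T (q ∸ 1) (suc (suc j)) ≤ᵇ T q (suc j) | ≤ᵇ-reflects-≤ (T (q ∸ 1) (suc (suc j))) (T q (suc j))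
  ...   | true  | ofʸ down≤ = viaDown (λ _ _ → down≤) m
  ...   | false | _         = viaLeft m
  byCases m | true  | false | ofⁿ noLeft = viaDown (λ _ left → ⊥-elim (noLeft left)) m
  byCases m | false | true  | _          = viaLeft m
  byCases () | false | false | _

deleteInColumn-other : ∀ T {i} r {p q} → q ≢ i → deleteInColumn T i r p q ≡ T p q
deleteInColumn-other T {i} r {q = q} q≢i with q ≡ᵇ i | ≡ᵇ-reflects-≡ q i
... | true  | ofʸ q≡i = ⊥-elim (q≢i q≡i)
... | false | _       = refl

deleteInColumn-below : ∀ T i {r p} → p < r → deleteInColumn T i r p i ≡ T p i
deleteInColumn-below T i {r} {p} p<r with i ≡ᵇ i | ≡ᵇ-reflects-≡ i i | p <ᵇ r | <ᵇ-reflects-< p r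
... | false | ofⁿ i≢i | _     | _        = ⊥-elim (i≢i refl)
... | true  | _       | true  | _        = refl
... | true  | _       | false | ofⁿ p≮r = ⊥-elim (p≮r p<r)

deleteInColumn-above : ∀ T i {r p} → r ≤ p → deleteInColumn T i r p i ≡ T (suc p) i
deleteInColumn-above T i {r} {p} r≤p with i ≡ᵇ i | ≡ᵇ-reflects-≡ i i | p <ᵇ r | <ᵇ-reflects-< p r
... | false | ofⁿ i≢i | _     | _        = ⊥-elim (i≢i refl)
... | true  | _       | true  | ofʸ p<r  = ⊥-elim (<⇒≱ p<r r≤p)
... | true  | _       | false | _        = refl

module _ {la : List ℕ} (desc : Descending la) {T : Filling} (ssrt : SSRT la T)
         {i : ℕ} (1≤i : 1 ≤ i) {r0 : ℕ} (1≤r0 : 1 ≤ r0) (rowLen-r0 : rowLen la r0 ≡ i)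
         {r : ℕ} (bound : UpperLeftBounded la T i r r0) where

  private
    positive = proj₁ ssrt
    rowDecreasing = proj₁ (proj₂ ssrt)
    columnDecreasing = proj₂ (proj₂ ssrt)
    shape′ = dropColumnTop-InShape⇒ desc 1≤r0 rowLen-r0

  deleteInColumn-positive : ∀ p q → InShape (dropColumnTop i la) p q → 1 ≤ deleteInColumn T i r p q
  deleteInColumn-positive p q box with shape′ p q box
  ... | inj₁ (q≢i , box′) rewrite deleteInColumn-other T r {p} q≢i = positive p q box′
  ... | inj₂ (refl , 1≤p , above) with p <? r
  ...   | yes p<r rewrite deleteInColumn-below T i p<r = positive p i (InShape-below desc 1≤p above)
  ...   | no p≮r  rewrite deleteInColumn-above T i (≮⇒≥ p≮r) = positive (suc p) i above

  deleteInColumn-rowDecreasing : ∀ p q → InShape (dropColumnTop i la) p q → InShape (dropColumnTop i la) p (suc q) →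
    deleteInColumn T i r p (suc q) ≤ deleteInColumn T i r p q
  deleteInColumn-rowDecreasing p q box box→ with shape′ p q box | shape′ p (suc q) box→
  ... | inj₁ (q≢i , left) | inj₁ (q+1≢i , right)
    rewrite deleteInColumn-other T r {p} q≢i | deleteInColumn-other T r {p} q+1≢i = rowDecreasing p q left right
  ... | inj₂ (refl , _) | inj₂ (i+1≡i , _) = ⊥-elim (1+n≢n i+1≡i)
  ... | inj₂ (refl , 1≤p , above) | inj₁ (i+1≢i , right) with p <? r
  ...   | yes p<r rewrite deleteInColumn-other T r {p} i+1≢i | deleteInColumn-below T q p<r =
    rowDecreasing p q (InShape-left {la} 1≤i right) right
  ...   | no p≮r  rewrite deleteInColumn-other T r {p} i+1≢i | deleteInColumn-above T q (≮⇒≥ p≮r) =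
    bound p (≮⇒≥ p≮r) (below-column-end desc 1≤r0 rowLen-r0 right) right above
  deleteInColumn-rowDecreasing p q box box→ | inj₁ (q≢i , left) | inj₂ (refl , 1≤p , above) with p <? r
  ... | yes p<r rewrite deleteInColumn-other T r {p} q≢i | deleteInColumn-below T (suc q) p<r =
    rowDecreasing p q left (InShape-below desc 1≤p above)
  ... | no p≮r  rewrite deleteInColumn-other T r {p} q≢i | deleteInColumn-above T (suc q) (≮⇒≥ p≮r) =
    ≤-trans (rowDecreasing (suc p) q aboveLeft above) (<⇒≤ (columnDecreasing p q left aboveLeft))
    where
    aboveLeft : InShape la (suc p) q
    aboveLeft = InShape-left {la} (proj₁ (proj₂ left)) above

  deleteInColumn-columnDecreasing : ∀ p q → InShape (dropColumnTop i la) p q → InShape (dropColumnTop i la) (suc p) q →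
    deleteInColumn T i r (suc p) q < deleteInColumn T i r p q
  deleteInColumn-columnDecreasing p q box box↑ with shape′ p q box | shape′ (suc p) q box↑
  ... | inj₁ (q≢i , lower) | inj₁ (_ , upper)
    rewrite deleteInColumn-other T r {p} q≢i | deleteInColumn-other T r {suc p} q≢i = columnDecreasing p q lower upper
  ... | inj₁ (q≢i , _) | inj₂ (q≡i , _) = ⊥-elim (q≢i q≡i)
  ... | inj₂ (refl , _) | inj₁ (i≢i , _) = ⊥-elim (i≢i refl)
  ... | inj₂ (refl , 1≤p , above) | inj₂ (_ , _ , above²) with suc p <? r | p <? r
  ...   | yes p+1<r | _
    rewrite deleteInColumn-below T i p+1<r | deleteInColumn-below T i (<-trans (n<1+n p) p+1<r) =
    columnDecreasing p i (InShape-below desc 1≤p above) above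
  ...   | no p+1≮r | yes p<r
    rewrite deleteInColumn-above T i (≮⇒≥ p+1≮r) | deleteInColumn-below T i p<r =
    <-trans (columnDecreasing (suc p) i above above²) (columnDecreasing p i (InShape-below desc 1≤p above) above)
  ...   | no p+1≮r | no p≮r
    rewrite deleteInColumn-above T i (≮⇒≥ p+1≮r) | deleteInColumn-above T i (≮⇒≥ p≮r) =
    columnDecreasing (suc p) i above above²

  deleteInColumn-SSRT : SSRT (dropColumnTop i la) (deleteInColumn T i r)
  deleteInColumn-SSRT = deleteInColumn-positive , deleteInColumn-rowDecreasing , deleteInColumn-columnDecreasing

lemma6p1 : (la : List ℕ) → IsPartition la →
    (T : Filling) → SSRT la T →
    (i : ℕ) → 1 ≤ i →
    (r0 : ℕ) → Addable la r0 (suc i) →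
    (r : ℕ) → ((r , i) , (r , suc i)) ∈ jdtMoves la T r0 (suc i) →
    ∃[ mu ] (IsPartition mu ×
      (∀ p q → InShape mu p q → InShape' la i p q) ×
      (∀ p q → InShape' la i p q → InShape mu p q) ×
      SSRT mu (deleteInColumn T i r))
lemma6p1 la partition@(desc , _) T ssrt (suc j) 1≤i r0 addable@(1≤r0 , _) r move =
  dropColumnTop (suc j) la ,
  dropColumnTop-isPartition (suc j) partition ,
  dropColumnTop-InShape⇒ desc 1≤r0 rowLen-r0 ,
  dropColumnTop-InShape⇐ desc 1≤i ,
  deleteInColumn-SSRT desc ssrt 1≤i 1≤r0 rowLen-r0 bound
  where
  rowLen-r0 : rowLen la r0 ≡ suc j
  rowLen-r0 = addable-rowLen {la} addable

  bound : UpperLeftBounded la T (suc j) r r0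
  bound = slide-UpperLeftBounded la T j r0 (r0 + suc (suc j)) r0 r (λ p r0≤p p<r0 → ⊥-elim (<⇒≱ p<r0 r0≤p)) move
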